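{- Let $D\in k[t]$ be negative, square-free, of odd degree, and let $Q\in\mathcal Q_D$. For every prime $p\in k[t]$, the value $(n,D)_p$ is the same for all $n\in k[t]$ coprime to $p$ that are properly represented by $Q$; moreover this value equals $1$ if $p\nmid D$. Also $(n,D)_\infty=1$ for every $n$ properly represented by $Q$.
   Context: $k$ is a number field; primes are monic irreducible polynomials, and $F_p=k[t]/(p)$. For $n\in k[t]$ coprime to a prime $p$, $(n,D)_p$ denotes the image of $n^{v_p(D)}$ in $F_p^\times/F_p^{\times2}$, where $v_p$ is the $p$-adic valuation. For nonzero $n,D\in k[t]$ with leading coefficients $n_0,D_0$, $(n,D)_\infty=(-1)^{\deg n\deg D}n_0^{\deg D}D_0^{\deg n}\in k^\times/k^{\times2}$. A polynomial $n$ is positive if $n\ne0$ and the leading coefficient of $(-1)^{\deg n}n$ lies in $(k^\times)^2$; negative if $-n$ is positive. A form $(a,b,c)$ denotes $ax^2+2bxy+cy^2$ with discriminant $b^2-ac$; it properly represents $n$ if $n=Q(x,y)$ with coprime $x,y\in k[t]$. $\mathcal Q_D$ is the set of forms over $k[t]$ of discriminant $D$ with $a$ positive. -}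

module Defs where

open import Level using (Level; _⊔_) renaming (suc to lsuc)
open import Algebra.Bundles using (CommutativeRing)
open import Data.Nat as ℕ using (ℕ; zero; suc; _<_; _≥_)
open import Data.Fin as Fin using (Fin)
open import Data.Product using (Σ; ∃; _×_; _,_)
open import Data.Sum using (_⊎_)
open import Data.List using (List; []; _∷_; map)
open import Relation.Nullary using (¬_)
open import Relation.Binary.PropositionalEquality using (_≡_)
import Data.Rational as ℚ
open ℚ using (ℚ)

-- A number field is a field k of characteristic 0 (witnessed by a unital
-- ring homomorphism ℚ → k, necessarily injective) which is a finite-
-- dimensional ℚ-vector space: it has a finite ℚ-basis e₀,…,e_{d-1}.

lincomb : ∀ {c ℓ} (R : CommutativeRing c ℓ) → (ℚ → CommutativeRing.Carrier R) →
          ∀ {n} → (Fin n → ℚ) → (Fin n → CommutativeRing.Carrier R) → CommutativeRing.Carrier R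
lincomb R ι {zero}  c e = CommutativeRing.0# R
lincomb R ι {suc n} c e = CommutativeRing._+_ R (CommutativeRing._*_ R (ι (c Fin.zero)) (e Fin.zero))
                            (lincomb R ι (λ i → c (Fin.suc i)) (λ i → e (Fin.suc i)))

record NumberField (c ℓ : Level) : Set (lsuc (c ⊔ ℓ)) where
  field
    commRing : CommutativeRing c ℓ
  open CommutativeRing commRing public
  field
    0≉1      : ¬ (0# ≈ 1#)
    inverse  : ∀ x → ¬ (x ≈ 0#) → ∃ λ y → x * y ≈ 1#
    ι        : ℚ → Carrier
    ι-1      : ι ℚ.1ℚ ≈ 1#
    ι-+      : ∀ a b → ι (a ℚ.+ b) ≈ ι a + ι b
    ι-*      : ∀ a b → ι (a ℚ.* b) ≈ ι a * ι b
    dim      : ℕ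
    basis    : Fin dim → Carrier

  field
    basis-spans : ∀ x → ∃ λ (c : Fin dim → ℚ) → x ≈ lincomb commRing ι c basis
    basis-indep : ∀ (c : Fin dim → ℚ) → lincomb commRing ι c basis ≈ 0# → ∀ i → c i ≡ ℚ.0ℚ

module PolyOver {c ℓ : Level} (k : NumberField c ℓ) where
  open NumberField k

  _^ₖ_ : Carrier → ℕ → Carrier
  x ^ₖ zero  = 1#
  x ^ₖ suc n = x * (x ^ₖ n)

  IsSquareₖ : Carrier → Set (c ⊔ ℓ)
  IsSquareₖ x = ∃ λ y → x ≈ y * y

  -- polynomials as coefficient lists, constant term first
  Poly : Set c
  Poly = List Carrier

  coeff : Poly → ℕ → Carrier
  coeff []       _       = 0#
  coeff (a ∷ f)  zero    = a
  coeff (a ∷ f)  (suc i) = coeff f i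

  -- equality of polynomials: equal coefficients (trailing zeros ignored)
  infix 4 _≈ₚ_
  _≈ₚ_ : Poly → Poly → Set ℓ
  f ≈ₚ g = ∀ i → coeff f i ≈ coeff g i

  infixl 6 _+ₚ_ _-ₚ_
  infixl 7 _*ₚ_
  _+ₚ_ : Poly → Poly → Poly
  []      +ₚ g       = g
  (a ∷ f) +ₚ []      = a ∷ f
  (a ∷ f) +ₚ (b ∷ g) = (a + b) ∷ (f +ₚ g)

  -ₚ_ : Poly → Poly
  -ₚ f = map -_ f

  _-ₚ_ : Poly → Poly → Poly
  f -ₚ g = f +ₚ (-ₚ g)

  _*ₚ_ : Poly → Poly → Poly
  []      *ₚ g = []
  (a ∷ f) *ₚ g = map (a *_) g +ₚ (0# ∷ (f *ₚ g))

  constₚ : Carrier → Poly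
  constₚ a = a ∷ []

  0ₚ 1ₚ 2ₚ : Poly
  0ₚ = []
  1ₚ = constₚ 1#
  2ₚ = constₚ (1# + 1#)

  _^ₚ_ : Poly → ℕ → Poly
  f ^ₚ zero  = 1ₚ
  f ^ₚ suc n = f *ₚ (f ^ₚ n)

  HasLead : Poly → ℕ → Carrier → Set ℓ
  HasLead f d a = (coeff f d ≈ a) × ¬ (a ≈ 0#) × (∀ i → d < i → coeff f i ≈ 0#)

  infix 4 _∣ₚ_
  _∣ₚ_ : Poly → Poly → Set (c ⊔ ℓ)
  f ∣ₚ g = ∃ λ h → f *ₚ h ≈ₚ g

  IsUnitₚ : Poly → Set (c ⊔ ℓ)
  IsUnitₚ f = f ∣ₚ 1ₚ

  Coprime : Poly → Poly → Set (c ⊔ ℓ)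
  Coprime f g = ∀ h → h ∣ₚ f → h ∣ₚ g → IsUnitₚ h

  -- primes of k[t]: monic irreducible polynomials
  IsPrime : Poly → Set (c ⊔ ℓ)
  IsPrime p = (∃ λ d → 1 ℕ.≤ d × HasLead p d 1#)
            × (∀ a b → a *ₚ b ≈ₚ p → IsUnitₚ a ⊎ IsUnitₚ b)

  SquareFree : Poly → Set (c ⊔ ℓ)
  SquareFree D = ∀ g → (g *ₚ g) ∣ₚ D → IsUnitₚ g

  OddDegree : Poly → Set (c ⊔ ℓ)
  OddDegree D = ∃ λ d → ∃ λ a → HasLead D d a × ∃ λ m → d ≡ suc (2 ℕ.* m)

  Positive : Poly → Set (c ⊔ ℓ)
  Positive n = ∃ λ d → ∃ λ a → HasLead n d a × IsSquareₖ (((- 1#) ^ₖ d) * a)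

  Negative : Poly → Set (c ⊔ ℓ)
  Negative n = Positive (-ₚ n)

  Val : Poly → Poly → ℕ → Set (c ⊔ ℓ)
  Val p D v = ((p ^ₚ v) ∣ₚ D) × ¬ ((p ^ₚ suc v) ∣ₚ D)

  -- equality of the images of a, b (units mod p) in F_p^× / F_p^{×2}:
  -- a ≡ b·y² (mod p) for some y invertible mod p
  SameSqClass : Poly → Poly → Poly → Set (c ⊔ ℓ)
  SameSqClass p a b = ∃ λ y → ¬ (p ∣ₚ y) × (p ∣ₚ (a -ₚ b *ₚ (y *ₚ y)))

  record Form : Set c where
    constructor form
    field
      fa fb fc : Poly

  disc : Form → Poly
  disc (form a b c') = b *ₚ b -ₚ a *ₚ c'

  eval : Form → Poly → Poly → Poly
  eval (form a b c') x y = a *ₚ (x *ₚ x) +ₚ 2ₚ *ₚ b *ₚ x *ₚ y +ₚ c' *ₚ (y *ₚ y)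

  In𝒬 : Poly → Form → Set (c ⊔ ℓ)
  In𝒬 D Q = (disc Q ≈ₚ D) × Positive (Form.fa Q)

  ProperlyRepresents : Form → Poly → Set (c ⊔ ℓ)
  ProperlyRepresents Q n = ∃ λ x → ∃ λ y → Coprime x y × (eval Q x y ≈ₚ n)

  -- (n,D)_∞ = 1 in k^×/k^{×2}, where deg n = dn, lead n = n₀, deg D = dD, lead D = D₀
  InftySymbolTrivial : ℕ → Carrier → ℕ → Carrier → Set (c ⊔ ℓ)
  InftySymbolTrivial dn n₀ dD D₀ =
    IsSquareₖ (((- 1#) ^ₖ (dn ℕ.* dD)) * (n₀ ^ₖ dD) * (D₀ ^ₖ dn))

-- Completing the square, a·Q(x, y) = (a x + b y)² − D y².
--
-- At a prime p, square-freeness leaves v_p(D) ∈ {0, 1}, and v_p(D) = 0 makes both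
-- claims trivial.  If p ∣ D, every represented n prime to p is ≡ K s² (mod p) with
-- p ∤ s, for one K depending only on Q: K = a⁻¹ if p ∤ a, and K = c if p ∣ a (then
-- also p ∣ b).  Hence any two such values differ by a square unit modulo p.
--
-- At infinity, D is negative of odd degree, so its leading coefficient D₀ is a square
-- and (−D) y² is zero or positive of odd degree, while z² is zero or positive of even
-- degree.  Their leading terms cannot cancel, so a n is positive, hence so is n, and
-- (n, D)_∞ = ((−1)^{deg n} n₀)^{deg D} · D₀^{deg n} is a square.

module Submission where

open import Defs
open import Level using (Level; _⊔_)
open import Algebra.Bundles using (CommutativeRing; RawRing)
import Algebra.Solver.Ring as RingSolver
import Algebra.Solver.Ring.AlmostCommutativeRing as ACR
open import Data.Empty using (⊥-elim)
open import Data.Fin as Fin using (Fin)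
open import Data.Fin.Properties using (all?)
open import Data.List using ([]; _∷_; map)
open import Data.Maybe using (Maybe; just; nothing)
open import Data.Nat as ℕ using (ℕ; zero; suc; z≤n; s≤s)
import Data.Nat.Properties as ℕ
open import Data.Nat.Induction using (<-rec)
open import Data.Nat.Tactic.RingSolver using (solve-∀)
open import Data.Product using (∃; _×_; _,_; proj₁; proj₂)
import Data.Rational as ℚ
import Data.Rational.Properties as ℚ
open import Data.Sum using (_⊎_; inj₁; inj₂; [_,_])
open import Relation.Binary.Definitions using (tri<; tri≈; tri>)
open import Relation.Binary.PropositionalEquality as ≡ using (_≡_; _≢_)
import Relation.Binary.Reasoning.Setoid as SetoidReasoning
open import Relation.Nullary using (¬_; Dec; yes; no)

-- The ring solver for an arbitrary commutative ring, with integer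
-- coefficients represented as pairs (p , q) standing for p − q.
module CommutativeRingSolver {a b} (R : CommutativeRing a b) where
  open CommutativeRing R
  open import Algebra.Properties.Semiring.Mult semiring
    using (×-homo-+; ×1-homo-*) renaming (_×_ to _×ₙ_)
  open import Algebra.Properties.Ring ring using (-‿distribˡ-*; -‿distribʳ-*)
  open import Algebra.Properties.AbelianGroup +-abelianGroup using (⁻¹-∙-comm)
  open import Algebra.Properties.Group +-group using (⁻¹-involutive)
  open import Algebra.Properties.CommutativeSemigroup +-commutativeSemigroup
    using (interchange)
  open SetoidReasoning setoid

  private
    ℤ-as-ℕ² : RawRing _ _
    ℤ-as-ℕ² = record
      { Carrier = ℕ × ℕ
      ; _≈_     = _≡_
      ; _+_     = λ { (p , q) (r , s) → (p ℕ.+ r , q ℕ.+ s) }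
      ; _*_     = λ { (p , q) (r , s) → (p ℕ.* r ℕ.+ q ℕ.* s , p ℕ.* s ℕ.+ q ℕ.* r) }
      ; -_      = λ { (p , q) → (q , p) }
      ; 0#      = (0 , 0)
      ; 1#      = (1 , 0)
      }

    ⟦_⟧ : ℕ × ℕ → Carrier
    ⟦ p , q ⟧ = p ×ₙ 1# - q ×ₙ 1#

    -‿+ : ∀ x y → - (x + y) ≈ - x + - y
    -‿+ x y = sym (⁻¹-∙-comm x y)

    -x*-y≈x*y : ∀ x y → - x * - y ≈ x * y
    -x*-y≈x*y x y = begin
      - x * - y     ≈⟨ -‿distribˡ-* x (- y) ⟨
      - (x * - y)   ≈⟨ -‿cong (-‿distribʳ-* x y) ⟨
      - - (x * y)   ≈⟨ ⁻¹-involutive (x * y) ⟩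
      x * y         ∎

    ⟦⟧-+ : ∀ u v → ⟦ RawRing._+_ ℤ-as-ℕ² u v ⟧ ≈ ⟦ u ⟧ + ⟦ v ⟧
    ⟦⟧-+ (p , q) (r , s) = begin
      (p ℕ.+ r) ×ₙ 1# - (q ℕ.+ s) ×ₙ 1#        ≈⟨ +-cong (×-homo-+ 1# p r) (-‿cong (×-homo-+ 1# q s)) ⟩
      (P + R′) - (Q + S)                          ≈⟨ +-congˡ (-‿+ Q S) ⟩
      (P + R′) + (- Q + - S)                      ≈⟨ interchange P R′ (- Q) (- S) ⟩
      (P - Q) + (R′ - S)                          ∎
      where P = p ×ₙ 1#; Q = q ×ₙ 1#; R′ = r ×ₙ 1#; S = s ×ₙ 1#

    ⟦⟧-* : ∀ u v → ⟦ RawRing._*_ ℤ-as-ℕ² u v ⟧ ≈ ⟦ u ⟧ * ⟦ v ⟧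
    ⟦⟧-* (p , q) (r , s) = begin
      (p ℕ.* r ℕ.+ q ℕ.* s) ×ₙ 1# - (p ℕ.* s ℕ.+ q ℕ.* r) ×ₙ 1#
        ≈⟨ +-cong (trans (×-homo-+ 1# (p ℕ.* r) (q ℕ.* s)) (+-cong (×1-homo-* p r) (×1-homo-* q s)))
                  (-‿cong (trans (×-homo-+ 1# (p ℕ.* s) (q ℕ.* r)) (+-cong (×1-homo-* p s) (×1-homo-* q r)))) ⟩
      (P * R′ + Q * S) - (P * S + Q * R′)         ≈⟨ +-congˡ (-‿+ (P * S) (Q * R′)) ⟩
      (P * R′ + Q * S) + (- (P * S) + - (Q * R′)) ≈⟨ interchange (P * R′) (Q * S) _ _ ⟩
      (P * R′ - P * S) + (Q * S + - (Q * R′))     ≈⟨ +-congˡ (+-comm (Q * S) _) ⟩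
      (P * R′ - P * S) + (- (Q * R′) + Q * S)
        ≈⟨ +-cong (+-congˡ (-‿distribʳ-* P S)) (+-cong (-‿distribˡ-* Q R′) (sym (-x*-y≈x*y Q S))) ⟩
      (P * R′ + P * - S) + (- Q * R′ + - Q * - S) ≈⟨ +-cong (distribˡ P R′ (- S)) (distribˡ (- Q) R′ (- S)) ⟨
      P * (R′ - S) + - Q * (R′ - S)               ≈⟨ distribʳ (R′ - S) P (- Q) ⟨
      (P - Q) * (R′ - S)                          ∎
      where P = p ×ₙ 1#; Q = q ×ₙ 1#; R′ = r ×ₙ 1#; S = s ×ₙ 1#

    ⟦⟧-‿ : ∀ u → ⟦ RawRing.-_ ℤ-as-ℕ² u ⟧ ≈ - ⟦ u ⟧
    ⟦⟧-‿ (p , q) = begin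
      Q - P          ≈⟨ +-comm Q (- P) ⟩
      - P + Q        ≈⟨ +-congˡ (⁻¹-involutive Q) ⟨
      - P + - - Q    ≈⟨ -‿+ P (- Q) ⟨
      - (P - Q)      ∎
      where P = p ×ₙ 1#; Q = q ×ₙ 1#

    -0≈0 : - 0# ≈ 0#
    -0≈0 = trans (sym (+-identityˡ (- 0#))) (-‿inverseʳ 0#)

    homomorphism : ℤ-as-ℕ² ACR.-Raw-AlmostCommutative⟶ ACR.fromCommutativeRing R
    homomorphism = record
      { ⟦_⟧    = ⟦_⟧
      ; +-homo = ⟦⟧-+
      ; *-homo = ⟦⟧-*
      ; -‿homo = ⟦⟧-‿
      ; 0-homo = -‿inverseʳ 0#
      ; 1-homo = trans (+-cong (+-identityʳ 1#) -0≈0) (+-identityʳ 1#)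
      }

    -- p − q ≈ r − s whenever p + s ≡ r + q; other coefficient equalities are not detected.
    ⟦⟧-≟ : ∀ u v → Maybe (⟦ u ⟧ ≈ ⟦ v ⟧)
    ⟦⟧-≟ (p , q) (r , s) with p ℕ.+ s ℕ.≟ r ℕ.+ q
    ... | no _  = nothing
    ... | yes e = just (begin
      P - Q                     ≈⟨ +-identityʳ (P - Q) ⟨
      (P - Q) + 0#              ≈⟨ +-congˡ (-‿inverseʳ S) ⟨
      (P - Q) + (S - S)         ≈⟨ interchange P (- Q) S (- S) ⟩
      (P + S) + (- Q - S)       ≈⟨ +-cong P+S≈R′+Q (+-comm (- Q) (- S)) ⟩
      (R′ + Q) + (- S - Q)      ≈⟨ interchange R′ Q (- S) (- Q) ⟩
      (R′ - S) + (Q - Q)        ≈⟨ +-congˡ (-‿inverseʳ Q) ⟩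
      (R′ - S) + 0#             ≈⟨ +-identityʳ (R′ - S) ⟩
      R′ - S                    ∎)
      where
      P = p ×ₙ 1#; Q = q ×ₙ 1#; R′ = r ×ₙ 1#; S = s ×ₙ 1#
      P+S≈R′+Q : P + S ≈ R′ + Q
      P+S≈R′+Q = trans (sym (×-homo-+ 1# p s)) (trans (reflexive (≡.cong (_×ₙ 1#) e)) (×-homo-+ 1# r q))

  open RingSolver ℤ-as-ℕ² (ACR.fromCommutativeRing R) homomorphism ⟦⟧-≟ public

module QuadraticForms {c ℓ : Level} (k : NumberField c ℓ) where
  open NumberField k hiding (zero; inverse)
  open NumberField k using () renaming (inverse to invert)
  open PolyOver k
  open import Algebra.Properties.Ring ring using (-‿distribˡ-*; -‿distribʳ-*; -1*x≈-x; x+x≈x⇒x≈0)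
  open import Algebra.Properties.Group +-group using (⁻¹-involutive; ε⁻¹≈ε)
  open import Algebra.Properties.Semiring.Exp semiring using (_^_; ^-congˡ; ^-homo-*; ^-assocʳ)
  open import Algebra.Properties.CommutativeSemiring.Exp commutativeSemiring using (^-distrib-*)
  open SetoidReasoning setoid
  module K = CommutativeRingSolver commRing

  -- Arithmetic in the number field

  ι-0 : ι ℚ.0ℚ ≈ 0#
  ι-0 = x+x≈x⇒x≈0 (ι ℚ.0ℚ) (sym (ι-+ ℚ.0ℚ ℚ.0ℚ))

  lincomb-zero : ∀ {n} (cs : Fin n → ℚ.ℚ) (e : Fin n → Carrier) →
                 (∀ i → cs i ≡ ℚ.0ℚ) → lincomb commRing ι cs e ≈ 0#
  lincomb-zero {zero}  cs e cs≡0 = refl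
  lincomb-zero {suc n} cs e cs≡0 = begin
    ι (cs Fin.zero) * e Fin.zero + lincomb commRing ι (λ i → cs (Fin.suc i)) (λ i → e (Fin.suc i))
      ≈⟨ +-cong (*-congʳ (trans (reflexive (≡.cong ι (cs≡0 Fin.zero))) ι-0))
                (lincomb-zero (λ i → cs (Fin.suc i)) (λ i → e (Fin.suc i)) (λ i → cs≡0 (Fin.suc i))) ⟩
    0# * e Fin.zero + 0#  ≈⟨ +-identityʳ _ ⟩
    0# * e Fin.zero       ≈⟨ zeroˡ _ ⟩
    0#                    ∎

  -- A number field has decidable equality: compare coordinates in the ℚ-basis.
  ≈0? : ∀ x → Dec (x ≈ 0#)
  ≈0? x with basis-spans x
  ... | cs , x≈ with all? (λ i → cs i ℚ.≟ ℚ.0ℚ)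
  ... | yes cs≡0 = yes (trans x≈ (lincomb-zero cs basis cs≡0))
  ... | no cs≢0  = no λ x≈0 → cs≢0 (basis-indep cs (trans (sym x≈) x≈0))

  1≉0 : ¬ 1# ≈ 0#
  1≉0 1≈0 = 0≉1 (sym 1≈0)

  *-cancelˡ-≈0 : ∀ {x y} → ¬ x ≈ 0# → x * y ≈ 0# → y ≈ 0#
  *-cancelˡ-≈0 {x} {y} x≉0 xy≈0 with invert x x≉0
  ... | x⁻¹ , xx⁻¹≈1 = begin
    y               ≈⟨ *-identityˡ y ⟨
    1# * y          ≈⟨ *-congʳ (trans (sym xx⁻¹≈1) (*-comm x x⁻¹)) ⟩
    (x⁻¹ * x) * y   ≈⟨ *-assoc x⁻¹ x y ⟩
    x⁻¹ * (x * y)   ≈⟨ *-congˡ xy≈0 ⟩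
    x⁻¹ * 0#        ≈⟨ zeroʳ x⁻¹ ⟩
    0#              ∎

  *-≉0 : ∀ {x y} → ¬ x ≈ 0# → ¬ y ≈ 0# → ¬ x * y ≈ 0#
  *-≉0 x≉0 y≉0 xy≈0 = y≉0 (*-cancelˡ-≈0 x≉0 xy≈0)

  -‿≉0 : ∀ {x} → ¬ x ≈ 0# → ¬ - x ≈ 0#
  -‿≉0 {x} x≉0 -x≈0 = x≉0 (trans (sym (⁻¹-involutive x)) (trans (-‿cong -x≈0) ε⁻¹≈ε))

  ^ₖ≡^ : ∀ x n → x ^ₖ n ≡ x ^ n
  ^ₖ≡^ x zero    = ≡.refl
  ^ₖ≡^ x (suc n) = ≡.cong (x *_) (^ₖ≡^ x n)

  1^ₖ : ∀ m → 1# ^ₖ m ≈ 1#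
  1^ₖ zero    = refl
  1^ₖ (suc m) = trans (*-identityˡ _) (1^ₖ m)

  -1^ₖ-even : ∀ m → (- 1#) ^ₖ (2 ℕ.* m) ≈ 1#
  -1^ₖ-even m = begin
    (- 1#) ^ₖ (2 ℕ.* m)  ≡⟨ ^ₖ≡^ (- 1#) (2 ℕ.* m) ⟩
    (- 1#) ^ (2 ℕ.* m)   ≈⟨ ^-assocʳ (- 1#) 2 m ⟨
    ((- 1#) ^ 2) ^ m     ≈⟨ ^-congˡ m (trans (*-congˡ (*-identityʳ (- 1#))) (trans (-1*x≈-x (- 1#)) (⁻¹-involutive 1#))) ⟩
    1# ^ m               ≡⟨ ^ₖ≡^ 1# m ⟨
    1# ^ₖ m              ≈⟨ 1^ₖ m ⟩
    1#                   ∎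

  -1^ₖ-odd : ∀ m → (- 1#) ^ₖ suc (2 ℕ.* m) ≈ - 1#
  -1^ₖ-odd m = trans (*-congˡ (-1^ₖ-even m)) (*-identityʳ (- 1#))

  -1^ₖ-≉0 : ∀ n → ¬ (- 1#) ^ₖ n ≈ 0#
  -1^ₖ-≉0 zero    = 1≉0
  -1^ₖ-≉0 (suc n) = *-≉0 (-‿≉0 1≉0) (-1^ₖ-≉0 n)

  ^ₖ-+ : ∀ x m n → x ^ₖ (m ℕ.+ n) ≈ x ^ₖ m * x ^ₖ n
  ^ₖ-+ x m n rewrite ^ₖ≡^ x (m ℕ.+ n) | ^ₖ≡^ x m | ^ₖ≡^ x n = ^-homo-* x m n

  ^ₖ-*ℕ : ∀ x m n → x ^ₖ (m ℕ.* n) ≈ (x ^ₖ m) ^ₖ n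
  ^ₖ-*ℕ x m n rewrite ^ₖ≡^ (x ^ₖ m) n | ^ₖ≡^ x m | ^ₖ≡^ x (m ℕ.* n) = sym (^-assocʳ x m n)

  ^ₖ-distrib-* : ∀ x y n → (x * y) ^ₖ n ≈ x ^ₖ n * y ^ₖ n
  ^ₖ-distrib-* x y n rewrite ^ₖ≡^ (x * y) n | ^ₖ≡^ x n | ^ₖ≡^ y n = ^-distrib-* x y n

  -1^ₖ-interchange : ∀ d e a b → (- 1#) ^ₖ (d ℕ.+ e) * (a * b) ≈ ((- 1#) ^ₖ d * a) * ((- 1#) ^ₖ e * b)
  -1^ₖ-interchange d e a b = trans (*-congʳ (^ₖ-+ (- 1#) d e))
    (K.solve 4 (λ u v a b → (u K.:* v) K.:* (a K.:* b) K.:= (u K.:* a) K.:* (v K.:* b)) refl _ _ a b)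

  IsSquareₖ-cong : ∀ {x y} → x ≈ y → IsSquareₖ x → IsSquareₖ y
  IsSquareₖ-cong x≈y (r , x≈rr) = r , trans (sym x≈y) x≈rr

  x*x-IsSquareₖ : ∀ x → IsSquareₖ (x * x)
  x*x-IsSquareₖ x = x , refl

  IsSquareₖ-* : ∀ {x y} → IsSquareₖ x → IsSquareₖ y → IsSquareₖ (x * y)
  IsSquareₖ-* (r , x≈rr) (t , y≈tt) = r * t , trans (*-cong x≈rr y≈tt)
    (K.solve 2 (λ r t → (r K.:* r) K.:* (t K.:* t) K.:= (r K.:* t) K.:* (r K.:* t)) refl r t)

  IsSquareₖ-^ₖ : ∀ {x} n → IsSquareₖ x → IsSquareₖ (x ^ₖ n)
  IsSquareₖ-^ₖ zero    _  = 1# , sym (*-identityˡ 1#)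
  IsSquareₖ-^ₖ (suc n) sq = IsSquareₖ-* sq (IsSquareₖ-^ₖ n sq)

  IsSquareₖ-cancelˡ : ∀ {x y} → ¬ x ≈ 0# → IsSquareₖ x → IsSquareₖ (x * y) → IsSquareₖ y
  IsSquareₖ-cancelˡ {x} {y} x≉0 (t , x≈tt) (s , xy≈ss)
    with invert t (λ t≈0 → x≉0 (trans x≈tt (trans (*-congʳ t≈0) (zeroˡ t))))
  ... | t⁻¹ , tt⁻¹≈1 = s * t⁻¹ , (begin
    y                               ≈⟨ *-identityˡ y ⟨
    1# * y                          ≈⟨ *-congʳ (trans (sym (*-identityˡ 1#)) (sym (*-cong tt⁻¹≈1 tt⁻¹≈1))) ⟩
    ((t * t⁻¹) * (t * t⁻¹)) * y
      ≈⟨ K.solve 3 (λ t u y → ((t K.:* u) K.:* (t K.:* u)) K.:* y K.:= ((t K.:* t) K.:* y) K.:* (u K.:* u)) refl t t⁻¹ y ⟩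
    ((t * t) * y) * (t⁻¹ * t⁻¹)     ≈⟨ *-congʳ (trans (*-congʳ (sym x≈tt)) xy≈ss) ⟩
    (s * s) * (t⁻¹ * t⁻¹)
      ≈⟨ K.solve 2 (λ s u → (s K.:* s) K.:* (u K.:* u) K.:= (s K.:* u) K.:* (s K.:* u)) refl s t⁻¹ ⟩
    (s * t⁻¹) * (s * t⁻¹)           ∎)

  -- The polynomial ring

  coeff-+ₚ : ∀ f g i → coeff (f +ₚ g) i ≈ coeff f i + coeff g i
  coeff-+ₚ []      g       i       = sym (+-identityˡ _)
  coeff-+ₚ (a ∷ f) []      i       = sym (+-identityʳ _)
  coeff-+ₚ (a ∷ f) (b ∷ g) zero    = refl
  coeff-+ₚ (a ∷ f) (b ∷ g) (suc i) = coeff-+ₚ f g i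

  coeff-scale : ∀ a g i → coeff (map (a *_) g) i ≈ a * coeff g i
  coeff-scale a []      i       = sym (zeroʳ a)
  coeff-scale a (b ∷ g) zero    = refl
  coeff-scale a (b ∷ g) (suc i) = coeff-scale a g i

  coeff-negₚ : ∀ f i → coeff (-ₚ f) i ≈ - coeff f i
  coeff-negₚ []      i       = sym ε⁻¹≈ε
  coeff-negₚ (a ∷ f) zero    = refl
  coeff-negₚ (a ∷ f) (suc i) = coeff-negₚ f i

  coeff-cons-*ₚ : ∀ a f g i → coeff ((a ∷ f) *ₚ g) i ≈ a * coeff g i + coeff (0# ∷ f *ₚ g) i
  coeff-cons-*ₚ a f g i = trans (coeff-+ₚ (map (a *_) g) (0# ∷ f *ₚ g) i) (+-congʳ (coeff-scale a g i))

  coeff-cons-*ₚ-zero : ∀ a f g → coeff ((a ∷ f) *ₚ g) zero ≈ a * coeff g zero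
  coeff-cons-*ₚ-zero a f g = trans (coeff-cons-*ₚ a f g zero) (+-identityʳ _)

  coeff-cons-*ₚ-suc : ∀ a f g i → coeff ((a ∷ f) *ₚ g) (suc i) ≈ a * coeff g (suc i) + coeff (f *ₚ g) i
  coeff-cons-*ₚ-suc a f g i = coeff-cons-*ₚ a f g (suc i)

  -- ≈ₚ wrapped in a record, so that both polynomials can be inferred from a proof.
  infix 4 _≋_
  record _≋_ (f g : Poly) : Set ℓ where
    constructor mk
    field coeff-≈ : f ≈ₚ g
  open _≋_ public

  ≋-refl : ∀ {f} → f ≋ f
  ≋-refl = mk λ _ → refl

  ≋-sym : ∀ {f g} → f ≋ g → g ≋ f
  ≋-sym (mk f≈g) = mk λ i → sym (f≈g i)

  ≋-trans : ∀ {f g h} → f ≋ g → g ≋ h → f ≋ h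
  ≋-trans (mk f≈g) (mk g≈h) = mk λ i → trans (f≈g i) (g≈h i)

  cons-cong : ∀ {a b f g} → a ≈ b → f ≋ g → (a ∷ f) ≋ (b ∷ g)
  cons-cong a≈b (mk f≈g) = mk λ { zero → a≈b ; (suc i) → f≈g i }

  scale-cong : ∀ {a b f g} → a ≈ b → f ≋ g → map (a *_) f ≋ map (b *_) g
  scale-cong {a} {b} {f} {g} a≈b (mk f≈g) = mk λ i →
    trans (coeff-scale a f i) (trans (*-cong a≈b (f≈g i)) (sym (coeff-scale b g i)))

  +ₚ-cong : ∀ {f f′ g g′} → f ≋ f′ → g ≋ g′ → f +ₚ g ≋ f′ +ₚ g′
  +ₚ-cong {f} {f′} {g} {g′} (mk f≈f′) (mk g≈g′) = mk λ i →
    trans (coeff-+ₚ f g i) (trans (+-cong (f≈f′ i) (g≈g′ i)) (sym (coeff-+ₚ f′ g′ i)))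

  -ₚ-cong : ∀ {f f′} → f ≋ f′ → -ₚ f ≋ -ₚ f′
  -ₚ-cong {f} {f′} (mk f≈f′) = mk λ i →
    trans (coeff-negₚ f i) (trans (-‿cong (f≈f′ i)) (sym (coeff-negₚ f′ i)))

  +ₚ-comm : ∀ f g → f +ₚ g ≋ g +ₚ f
  +ₚ-comm f g = mk λ i → trans (coeff-+ₚ f g i) (trans (+-comm _ _) (sym (coeff-+ₚ g f i)))

  +ₚ-assoc : ∀ f g h → (f +ₚ g) +ₚ h ≋ f +ₚ (g +ₚ h)
  +ₚ-assoc f g h = mk λ i → begin
    coeff ((f +ₚ g) +ₚ h) i                ≈⟨ trans (coeff-+ₚ (f +ₚ g) h i) (+-congʳ (coeff-+ₚ f g i)) ⟩
    (coeff f i + coeff g i) + coeff h i    ≈⟨ +-assoc _ _ _ ⟩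
    coeff f i + (coeff g i + coeff h i)    ≈⟨ sym (trans (coeff-+ₚ f (g +ₚ h) i) (+-congˡ (coeff-+ₚ g h i))) ⟩
    coeff (f +ₚ (g +ₚ h)) i                ∎

  +ₚ-identityʳ : ∀ f → f +ₚ [] ≋ f
  +ₚ-identityʳ f = mk λ i → trans (coeff-+ₚ f [] i) (+-identityʳ _)

  -ₚ-inverseˡ : ∀ f → -ₚ f +ₚ f ≋ []
  -ₚ-inverseˡ f = mk λ i → trans (coeff-+ₚ (-ₚ f) f i) (trans (+-congʳ (coeff-negₚ f i)) (-‿inverseˡ _))

  -ₚ-inverseʳ : ∀ f → f +ₚ -ₚ f ≋ []
  -ₚ-inverseʳ f = ≋-trans (+ₚ-comm f (-ₚ f)) (-ₚ-inverseˡ f)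

  *ₚ-zeroˡ : ∀ {f} g → f ≋ [] → f *ₚ g ≋ []
  *ₚ-zeroˡ {[]}    g _        = ≋-refl
  *ₚ-zeroˡ {a ∷ f} g (mk f≈0) = mk λ
    { zero    → trans (coeff-cons-*ₚ-zero a f g) (trans (*-congʳ (f≈0 zero)) (zeroˡ _))
    ; (suc i) → trans (coeff-cons-*ₚ-suc a f g i)
                  (trans (+-cong (trans (*-congʳ (f≈0 zero)) (zeroˡ _)) (coeff-≈ (*ₚ-zeroˡ {f} g (mk λ j → f≈0 (suc j))) i))
                         (+-identityʳ 0#)) }

  *ₚ-zeroʳ : ∀ f → f *ₚ [] ≋ []
  *ₚ-zeroʳ []      = ≋-refl
  *ₚ-zeroʳ (a ∷ f) = mk λ { zero → refl ; (suc i) → coeff-≈ (*ₚ-zeroʳ f) i }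

  *ₚ-congʳ : ∀ f {g g′} → g ≋ g′ → f *ₚ g ≋ f *ₚ g′
  *ₚ-congʳ []      g≋g′ = ≋-refl
  *ₚ-congʳ (a ∷ f) g≋g′ = +ₚ-cong (scale-cong refl g≋g′) (cons-cong refl (*ₚ-congʳ f g≋g′))

  *ₚ-congˡ : ∀ {f f′} g → f ≋ f′ → f *ₚ g ≋ f′ *ₚ g
  *ₚ-congˡ {[]}    {[]}     g _    = ≋-refl
  *ₚ-congˡ {[]}    {a ∷ f′} g f≋f′ = ≋-sym (*ₚ-zeroˡ g (≋-sym f≋f′))
  *ₚ-congˡ {a ∷ f} {[]}     g f≋f′ = *ₚ-zeroˡ g f≋f′
  *ₚ-congˡ {a ∷ f} {b ∷ f′} g (mk f≈f′) =
    +ₚ-cong (scale-cong (f≈f′ zero) ≋-refl) (cons-cong refl (*ₚ-congˡ {f} {f′} g (mk λ j → f≈f′ (suc j))))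

  *ₚ-cong : ∀ {f f′ g g′} → f ≋ f′ → g ≋ g′ → f *ₚ g ≋ f′ *ₚ g′
  *ₚ-cong {f} {f′} {g} f≋f′ g≋g′ = ≋-trans (*ₚ-congˡ g f≋f′) (*ₚ-congʳ f′ g≋g′)

  *ₚ-cons : ∀ f b g → f *ₚ (b ∷ g) ≋ map (b *_) f +ₚ (0# ∷ f *ₚ g)
  *ₚ-cons []      b g = mk λ { zero → refl ; (suc i) → refl }
  *ₚ-cons (a ∷ f) b g = mk λ
    { zero    → trans (coeff-cons-*ₚ-zero a f (b ∷ g)) (trans (*-comm a b) (sym (+-identityʳ _)))
    ; (suc i) → begin
        coeff ((a ∷ f) *ₚ (b ∷ g)) (suc i)
          ≈⟨ coeff-cons-*ₚ-suc a f (b ∷ g) i ⟩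
        a * coeff g i + coeff (f *ₚ (b ∷ g)) i
          ≈⟨ +-congˡ (trans (coeff-≈ (*ₚ-cons f b g) i) (coeff-+ₚ (map (b *_) f) (0# ∷ f *ₚ g) i)) ⟩
        a * coeff g i + (coeff (map (b *_) f) i + coeff (0# ∷ f *ₚ g) i)
          ≈⟨ K.solve 3 (λ x y z → x K.:+ (y K.:+ z) K.:= y K.:+ (x K.:+ z)) refl _ _ _ ⟩
        coeff (map (b *_) f) i + (a * coeff g i + coeff (0# ∷ f *ₚ g) i)
          ≈⟨ +-congˡ (coeff-cons-*ₚ a f g i) ⟨
        coeff (map (b *_) f) i + coeff ((a ∷ f) *ₚ g) i
          ≈⟨ coeff-+ₚ (map (b *_) f) ((a ∷ f) *ₚ g) i ⟨
        coeff (map (b *_) (a ∷ f) +ₚ (0# ∷ (a ∷ f) *ₚ g)) (suc i)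
          ∎ }

  *ₚ-comm : ∀ f g → f *ₚ g ≋ g *ₚ f
  *ₚ-comm []      g = ≋-sym (*ₚ-zeroʳ g)
  *ₚ-comm (a ∷ f) g = ≋-trans (+ₚ-cong ≋-refl (cons-cong refl (*ₚ-comm f g))) (≋-sym (*ₚ-cons g a f))

  *ₚ-distribˡ : ∀ f g h → f *ₚ (g +ₚ h) ≋ f *ₚ g +ₚ f *ₚ h
  *ₚ-distribˡ []      g h = ≋-refl
  *ₚ-distribˡ (a ∷ f) g h = mk λ
    { zero    → begin
        coeff ((a ∷ f) *ₚ (g +ₚ h)) zero                ≈⟨ coeff-cons-*ₚ-zero a f (g +ₚ h) ⟩
        a * coeff (g +ₚ h) zero                         ≈⟨ trans (*-congˡ (coeff-+ₚ g h zero)) (distribˡ a _ _) ⟩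
        a * coeff g zero + a * coeff h zero             ≈⟨ +-cong (coeff-cons-*ₚ-zero a f g) (coeff-cons-*ₚ-zero a f h) ⟨
        coeff ((a ∷ f) *ₚ g) zero + coeff ((a ∷ f) *ₚ h) zero ≈⟨ coeff-+ₚ ((a ∷ f) *ₚ g) ((a ∷ f) *ₚ h) zero ⟨
        coeff ((a ∷ f) *ₚ g +ₚ (a ∷ f) *ₚ h) zero       ∎
    ; (suc i) → begin
        coeff ((a ∷ f) *ₚ (g +ₚ h)) (suc i)
          ≈⟨ coeff-cons-*ₚ-suc a f (g +ₚ h) i ⟩
        a * coeff (g +ₚ h) (suc i) + coeff (f *ₚ (g +ₚ h)) i
          ≈⟨ +-cong (*-congˡ (coeff-+ₚ g h (suc i)))
                    (trans (coeff-≈ (*ₚ-distribˡ f g h) i) (coeff-+ₚ (f *ₚ g) (f *ₚ h) i)) ⟩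
        a * (coeff g (suc i) + coeff h (suc i)) + (coeff (f *ₚ g) i + coeff (f *ₚ h) i)
          ≈⟨ K.solve 5 (λ a x y u v → a K.:* (x K.:+ y) K.:+ (u K.:+ v) K.:= (a K.:* x K.:+ u) K.:+ (a K.:* y K.:+ v))
                       refl _ _ _ _ _ ⟩
        (a * coeff g (suc i) + coeff (f *ₚ g) i) + (a * coeff h (suc i) + coeff (f *ₚ h) i)
          ≈⟨ +-cong (coeff-cons-*ₚ-suc a f g i) (coeff-cons-*ₚ-suc a f h i) ⟨
        coeff ((a ∷ f) *ₚ g) (suc i) + coeff ((a ∷ f) *ₚ h) (suc i)
          ≈⟨ coeff-+ₚ ((a ∷ f) *ₚ g) ((a ∷ f) *ₚ h) (suc i) ⟨
        coeff ((a ∷ f) *ₚ g +ₚ (a ∷ f) *ₚ h) (suc i)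
          ∎ }

  *ₚ-distribʳ : ∀ h f g → (f +ₚ g) *ₚ h ≋ f *ₚ h +ₚ g *ₚ h
  *ₚ-distribʳ h f g = ≋-trans (*ₚ-comm (f +ₚ g) h)
    (≋-trans (*ₚ-distribˡ h f g) (+ₚ-cong (*ₚ-comm h f) (*ₚ-comm h g)))

  scale-*ₚ : ∀ a g h → map (a *_) g *ₚ h ≋ map (a *_) (g *ₚ h)
  scale-*ₚ a []      h = ≋-refl
  scale-*ₚ a (b ∷ g) h = mk λ
    { zero    → begin
        coeff ((a * b ∷ map (a *_) g) *ₚ h) zero  ≈⟨ coeff-cons-*ₚ-zero (a * b) (map (a *_) g) h ⟩
        a * b * coeff h zero                      ≈⟨ *-assoc a b _ ⟩
        a * (b * coeff h zero)                    ≈⟨ *-congˡ (coeff-cons-*ₚ-zero b g h) ⟨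
        a * coeff ((b ∷ g) *ₚ h) zero             ≈⟨ coeff-scale a ((b ∷ g) *ₚ h) zero ⟨
        coeff (map (a *_) ((b ∷ g) *ₚ h)) zero    ∎
    ; (suc i) → begin
        coeff ((a * b ∷ map (a *_) g) *ₚ h) (suc i)
          ≈⟨ coeff-cons-*ₚ-suc (a * b) (map (a *_) g) h i ⟩
        a * b * coeff h (suc i) + coeff (map (a *_) g *ₚ h) i
          ≈⟨ +-congˡ (trans (coeff-≈ (scale-*ₚ a g h) i) (coeff-scale a (g *ₚ h) i)) ⟩
        a * b * coeff h (suc i) + a * coeff (g *ₚ h) i
          ≈⟨ K.solve 4 (λ a b x y → a K.:* b K.:* x K.:+ a K.:* y K.:= a K.:* (b K.:* x K.:+ y)) refl _ _ _ _ ⟩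
        a * (b * coeff h (suc i) + coeff (g *ₚ h) i)
          ≈⟨ *-congˡ (coeff-cons-*ₚ-suc b g h i) ⟨
        a * coeff ((b ∷ g) *ₚ h) (suc i)
          ≈⟨ coeff-scale a ((b ∷ g) *ₚ h) (suc i) ⟨
        coeff (map (a *_) ((b ∷ g) *ₚ h)) (suc i)
          ∎ }

  shift-*ₚ : ∀ f h → (0# ∷ f) *ₚ h ≋ 0# ∷ f *ₚ h
  shift-*ₚ f h = mk λ
    { zero    → trans (coeff-cons-*ₚ-zero 0# f h) (zeroˡ _)
    ; (suc i) → trans (coeff-cons-*ₚ-suc 0# f h i) (trans (+-congʳ (zeroˡ _)) (+-identityˡ _)) }

  *ₚ-assoc : ∀ f g h → (f *ₚ g) *ₚ h ≋ f *ₚ (g *ₚ h)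
  *ₚ-assoc []      g h = ≋-refl
  *ₚ-assoc (a ∷ f) g h = ≋-trans (*ₚ-distribʳ h (map (a *_) g) (0# ∷ f *ₚ g))
    (+ₚ-cong (scale-*ₚ a g h) (≋-trans (shift-*ₚ (f *ₚ g) h) (cons-cong refl (*ₚ-assoc f g h))))

  *ₚ-identityˡ : ∀ f → 1ₚ *ₚ f ≋ f
  *ₚ-identityˡ f = mk λ
    { zero    → trans (coeff-cons-*ₚ-zero 1# [] f) (*-identityˡ _)
    ; (suc i) → trans (coeff-cons-*ₚ-suc 1# [] f i) (trans (+-identityʳ _) (*-identityˡ _)) }

  *ₚ-identityʳ : ∀ f → f *ₚ 1ₚ ≋ f
  *ₚ-identityʳ f = ≋-trans (*ₚ-comm f 1ₚ) (*ₚ-identityˡ f)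

  polynomialRing : CommutativeRing c ℓ
  polynomialRing = record
    { Carrier = Poly ; _≈_ = _≋_ ; _+_ = _+ₚ_ ; _*_ = _*ₚ_ ; -_ = -ₚ_ ; 0# = [] ; 1# = 1ₚ
    ; isCommutativeRing = record
      { isRing = record
        { +-isAbelianGroup = record
          { isGroup = record
            { isMonoid = record
              { isSemigroup = record
                { isMagma = record
                  { isEquivalence = record { refl = ≋-refl ; sym = ≋-sym ; trans = ≋-trans }
                  ; ∙-cong = +ₚ-cong }
                ; assoc = +ₚ-assoc }
              ; identity = (λ _ → ≋-refl) , +ₚ-identityʳ }
            ; inverse = -ₚ-inverseˡ , -ₚ-inverseʳ
            ; ⁻¹-cong = -ₚ-cong }
          ; comm = +ₚ-comm }
        ; *-cong = *ₚ-cong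
        ; *-assoc = *ₚ-assoc
        ; *-identity = *ₚ-identityˡ , *ₚ-identityʳ
        ; distrib = *ₚ-distribˡ , *ₚ-distribʳ }
      ; *-comm = *ₚ-comm } }

  open CommutativeRingSolver polynomialRing using (solve; _:+_; _:*_; _:-_; :-_; _:=_; con)

  completing-the-square : ∀ a b c′ x y → a *ₚ eval (form a b c′) x y ≋
            (a *ₚ x +ₚ b *ₚ y) *ₚ (a *ₚ x +ₚ b *ₚ y) -ₚ disc (form a b c′) *ₚ (y *ₚ y)
  completing-the-square = solve 5 (λ a b c′ x y →
    a :* (a :* (x :* x) :+ con (2 , 0) :* b :* x :* y :+ c′ :* (y :* y))
    := (a :* x :+ b :* y) :* (a :* x :+ b :* y) :- (b :* b :- a :* c′) :* (y :* y)) ≋-refl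

  -- Leading coefficients and divisibility

  DegreeBelow : Poly → ℕ → Set ℓ
  DegreeBelow f d = ∀ i → d ℕ.≤ i → coeff f i ≈ 0#

  zero-or-HasLead : ∀ f → f ≋ [] ⊎ ∃ λ d → ∃ λ a → HasLead f d a
  zero-or-HasLead []      = inj₁ ≋-refl
  zero-or-HasLead (a ∷ f) with zero-or-HasLead f
  ... | inj₂ (d , b , (f_d≈b , b≉0 , above)) = inj₂ (suc d , b , f_d≈b , b≉0 , λ { (suc i) (s≤s d<i) → above i d<i })
  ... | inj₁ (mk f≈0) with ≈0? a
  ...   | yes a≈0 = inj₁ (mk λ { zero → a≈0 ; (suc i) → f≈0 i })
  ...   | no a≉0  = inj₂ (zero , a , refl , a≉0 , λ { (suc i) _ → f≈0 i })

  HasLead⇒≉[] : ∀ {f d a} → HasLead f d a → ¬ f ≋ []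
  HasLead⇒≉[] {d = d} (f_d≈a , a≉0 , _) (mk f≈0) = a≉0 (trans (sym f_d≈a) (f≈0 d))

  HasLead-unique : ∀ {f d e a b} → HasLead f d a → HasLead f e b → d ≡ e × a ≈ b
  HasLead-unique {d = d} {e} (f_d≈a , a≉0 , above-d) (f_e≈b , b≉0 , above-e) with ℕ.<-cmp d e
  ... | tri< d<e _ _   = ⊥-elim (b≉0 (trans (sym f_e≈b) (above-d e d<e)))
  ... | tri> _ _ e<d   = ⊥-elim (a≉0 (trans (sym f_d≈a) (above-e d e<d)))
  ... | tri≈ _ ≡.refl _ = ≡.refl , trans (sym f_d≈a) f_e≈b

  HasLead-resp-≋ : ∀ {f g d a} → f ≋ g → HasLead f d a → HasLead g d a
  HasLead-resp-≋ {d = d} (mk f≈g) (f_d≈a , a≉0 , above) =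
    trans (sym (f≈g d)) f_d≈a , a≉0 , λ i d<i → trans (sym (f≈g i)) (above i d<i)

  HasLead⇒DegreeBelow : ∀ {f d a e} → HasLead f d a → d ℕ.< e → DegreeBelow f e
  HasLead⇒DegreeBelow (_ , _ , above) d<e i e≤i = above i (ℕ.<-≤-trans d<e e≤i)

  DegreeBelow-HasLead⇒< : ∀ {f e d a} → DegreeBelow f e → HasLead f d a → d ℕ.< e
  DegreeBelow-HasLead⇒< {e = e} {d} below (f_d≈a , a≉0 , _) with d ℕ.<? e
  ... | yes d<e = d<e
  ... | no d≮e  = ⊥-elim (a≉0 (trans (sym f_d≈a) (below d (ℕ.≮⇒≥ d≮e))))

  HasLead-+ˡ : ∀ {f g d a} → HasLead f d a → DegreeBelow g d → HasLead (f +ₚ g) d a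
  HasLead-+ˡ {f} {g} {d} (f_d≈a , a≉0 , above) g-below =
    trans (coeff-+ₚ f g d) (trans (+-cong f_d≈a (g-below d ℕ.≤-refl)) (+-identityʳ _)) , a≉0 ,
    λ i d<i → trans (coeff-+ₚ f g i) (trans (+-cong (above i d<i) (g-below i (ℕ.<⇒≤ d<i))) (+-identityʳ _))

  HasLead-+ʳ : ∀ {f g d a} → DegreeBelow f d → HasLead g d a → HasLead (f +ₚ g) d a
  HasLead-+ʳ {f} {g} f-below g-lead = HasLead-resp-≋ (+ₚ-comm g f) (HasLead-+ˡ {g} {f} g-lead f-below)

  HasLead-negₚ : ∀ {f d a} → HasLead f d a → HasLead (-ₚ f) d (- a)
  HasLead-negₚ {f} {d} (f_d≈a , a≉0 , above) =
    trans (coeff-negₚ f d) (-‿cong f_d≈a) , -‿≉0 a≉0 ,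
    λ i d<i → trans (coeff-negₚ f i) (trans (-‿cong (above i d<i)) ε⁻¹≈ε)

  HasLead-1ₚ : HasLead 1ₚ 0 1#
  HasLead-1ₚ = refl , 1≉0 , λ { (suc i) _ → refl }

  HasLead-*ₚ : ∀ {f g d e a b} → HasLead f d a → HasLead g e b → HasLead (f *ₚ g) (d ℕ.+ e) (a * b)
  HasLead-*ₚ {[]} (f_d≈a , a≉0 , _) _ = ⊥-elim (a≉0 (sym f_d≈a))
  HasLead-*ₚ {a′ ∷ f} {g} {zero} {e} (a′≈a , a≉0 , above) (g_e≈b , b≉0 , g-above) =
    trans (constant-*ₚ e) (*-cong a′≈a g_e≈b) , *-≉0 a≉0 b≉0 ,
    λ i e<i → trans (constant-*ₚ i) (trans (*-congˡ (g-above i e<i)) (zeroʳ _))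
    where
    f≋[] : f ≋ []
    f≋[] = mk λ i → above (suc i) (s≤s z≤n)
    constant-*ₚ : ∀ i → coeff ((a′ ∷ f) *ₚ g) i ≈ a′ * coeff g i
    constant-*ₚ zero    = coeff-cons-*ₚ-zero a′ f g
    constant-*ₚ (suc i) = trans (coeff-cons-*ₚ-suc a′ f g i)
      (trans (+-congˡ (coeff-≈ (*ₚ-zeroˡ g f≋[]) i)) (+-identityʳ _))
  HasLead-*ₚ {a′ ∷ f} {g} {suc d} {e} (f_d≈a , a≉0 , above) g-lead@(_ , _ , g-above)
    with HasLead-*ₚ {f} {g} {d} (f_d≈a , a≉0 , λ i d<i → above (suc i) (s≤s d<i)) g-lead
  ... | (fg_de≈ab , ab≉0 , fg-above) =
    trans (coeff-cons-*ₚ-suc a′ f g (d ℕ.+ e))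
      (trans (+-cong (a′*g≈0 (s≤s (ℕ.m≤n+m e d))) fg_de≈ab) (+-identityˡ _)) ,
    ab≉0 ,
    λ { (suc i) (s≤s de<i) → trans (coeff-cons-*ₚ-suc a′ f g i)
          (trans (+-cong (a′*g≈0 (s≤s (ℕ.≤-trans (ℕ.m≤n+m e d) (ℕ.<⇒≤ de<i)))) (fg-above i de<i)) (+-identityʳ _)) }
    where
    a′*g≈0 : ∀ {i} → e ℕ.< i → a′ * coeff g i ≈ 0#
    a′*g≈0 {i} e<i = trans (*-congˡ (g-above i e<i)) (zeroʳ a′)

  infix 4 _∣_
  record _∣_ (f g : Poly) : Set (c ⊔ ℓ) where
    constructor divides
    field
      quotient : Poly
      equation : f *ₚ quotient ≋ g

  ∣ₚ⇒∣ : ∀ {f g} → f ∣ₚ g → f ∣ g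
  ∣ₚ⇒∣ (q , fq≈g) = divides q (mk fq≈g)

  ∣⇒∣ₚ : ∀ {f g} → f ∣ g → f ∣ₚ g
  ∣⇒∣ₚ (divides q fq≋g) = q , coeff-≈ fq≋g

  ∣-resp-≋ : ∀ {f g g′} → g ≋ g′ → f ∣ g → f ∣ g′
  ∣-resp-≋ g≋g′ (divides q fq≋g) = divides q (≋-trans fq≋g g≋g′)

  ∣-refl : ∀ {f} → f ∣ f
  ∣-refl {f} = divides 1ₚ (*ₚ-identityʳ f)

  ∣-[] : ∀ {f} → f ∣ []
  ∣-[] {f} = divides [] (*ₚ-zeroʳ f)

  ∣-trans : ∀ {f g h} → f ∣ g → g ∣ h → f ∣ h
  ∣-trans {f} (divides q fq≋g) (divides r gr≋h) =
    divides (q *ₚ r) (≋-trans (≋-sym (*ₚ-assoc f q r)) (≋-trans (*ₚ-congˡ r fq≋g) gr≋h))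

  ∣-*ʳ : ∀ {f g} h → f ∣ g → f ∣ g *ₚ h
  ∣-*ʳ {f} h (divides q fq≋g) = divides (q *ₚ h) (≋-trans (≋-sym (*ₚ-assoc f q h)) (*ₚ-congˡ h fq≋g))

  ∣-*ˡ : ∀ {f g} h → f ∣ g → f ∣ h *ₚ g
  ∣-*ˡ {f} {g} h f∣g = ∣-resp-≋ (*ₚ-comm g h) (∣-*ʳ h f∣g)

  ∣-+ : ∀ {f g h} → f ∣ g → f ∣ h → f ∣ g +ₚ h
  ∣-+ {f} (divides q fq≋g) (divides r fr≋h) =
    divides (q +ₚ r) (≋-trans (*ₚ-distribˡ f q r) (+ₚ-cong fq≋g fr≋h))

  ∣-negₚ : ∀ {f g} → f ∣ g → f ∣ -ₚ g
  ∣-negₚ {f} (divides q fq≋g) =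
    divides (-ₚ q) (≋-trans (solve 2 (λ f q → f :* (:- q) := :- (f :* q)) ≋-refl f q) (-ₚ-cong fq≋g))

  ∣-minus : ∀ {f g h} → f ∣ g → f ∣ h → f ∣ g -ₚ h
  ∣-minus f∣g f∣h = ∣-+ f∣g (∣-negₚ f∣h)

  ∣⇒deg≤ : ∀ {f d a g e b} → HasLead f d a → f ∣ g → HasLead g e b → d ℕ.≤ e
  ∣⇒deg≤ {f} {d} {g = g} f-lead (divides q fq≋g) g-lead with zero-or-HasLead q
  ... | inj₁ q≋[] = ⊥-elim (HasLead⇒≉[] g-lead (≋-trans (≋-sym fq≋g) (≋-trans (*ₚ-congʳ f q≋[]) (*ₚ-zeroʳ f))))
  ... | inj₂ (d′ , _ , q-lead)
    with HasLead-unique {g} (HasLead-resp-≋ {f *ₚ q} fq≋g (HasLead-*ₚ {f} {q} f-lead q-lead)) g-lead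
  ...   | ≡.refl , _ = ℕ.m≤m+n d d′

  HasLead⇒∤1ₚ : ∀ {f d a} → HasLead f (suc d) a → ¬ f ∣ 1ₚ
  HasLead⇒∤1ₚ {f} f-lead f∣1 with ∣⇒deg≤ {f} f-lead f∣1 HasLead-1ₚ
  ... | ()

  divMod : ∀ {g e b} → HasLead g (suc e) b → ∀ f →
           ∃ λ q → ∃ λ r → f ≋ g *ₚ q +ₚ r × DegreeBelow r (suc e)
  divMod {g} {e} {b} g-lead []      = [] , [] , ≋-sym (≋-trans (+ₚ-identityʳ (g *ₚ [])) (*ₚ-zeroʳ g)) , λ _ _ → refl
  divMod {g} {e} {b} g-lead@(g_e≈b , b≉0 , g-above) (a ∷ f) with divMod {g} g-lead f | invert b b≉0
  ... | q′ , r′ , f≋ , r′-below | b⁻¹ , bb⁻¹≈1 = cc ∷ q′ , r , a∷f≋ , r-below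
    where
    cc = b⁻¹ * coeff r′ e
    r  = (a ∷ r′) -ₚ map (cc *_) g
    a∷f≋ : a ∷ f ≋ g *ₚ (cc ∷ q′) +ₚ r
    a∷f≋ = ≋-trans (cons-cong (sym (+-identityˡ a)) f≋)
      (≋-trans (solve 3 (λ C U V → U :+ V := (C :+ U) :+ (V :- C)) ≋-refl (map (cc *_) g) (0# ∷ g *ₚ q′) (a ∷ r′))
               (+ₚ-cong (≋-sym (*ₚ-cons g cc q′)) ≋-refl))
    top : ∀ {j} → e ℕ.≤ j → coeff r′ j - cc * coeff g (suc j) ≈ 0#
    top e≤j with ℕ.m≤n⇒m<n∨m≡n e≤j
    ... | inj₁ e<j   = trans (+-cong (r′-below _ e<j) (-‿cong (trans (*-congˡ (g-above _ (s≤s e<j))) (zeroʳ cc))))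
                             (trans (+-identityˡ _) ε⁻¹≈ε)
    ... | inj₂ ≡.refl = begin
      coeff r′ e - cc * coeff g (suc e)   ≈⟨ +-congˡ (-‿cong (*-congˡ g_e≈b)) ⟩
      coeff r′ e - (b⁻¹ * coeff r′ e) * b
        ≈⟨ +-congˡ (-‿cong (K.solve 3 (λ u x b → (u K.:* x) K.:* b K.:= (b K.:* u) K.:* x) refl b⁻¹ (coeff r′ e) b)) ⟩
      coeff r′ e - (b * b⁻¹) * coeff r′ e ≈⟨ +-congˡ (-‿cong (trans (*-congʳ bb⁻¹≈1) (*-identityˡ _))) ⟩
      coeff r′ e - coeff r′ e             ≈⟨ -‿inverseʳ _ ⟩
      0#                                  ∎
    r-below : DegreeBelow r (suc e)
    r-below (suc j) (s≤s e≤j) = begin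
      coeff r (suc j)                               ≈⟨ coeff-+ₚ (a ∷ r′) (-ₚ map (cc *_) g) (suc j) ⟩
      coeff r′ j + coeff (-ₚ map (cc *_) g) (suc j)
        ≈⟨ +-congˡ (trans (coeff-negₚ (map (cc *_) g) (suc j)) (-‿cong (coeff-scale cc g (suc j)))) ⟩
      coeff r′ j - cc * coeff g (suc j)             ≈⟨ top e≤j ⟩
      0#                                            ∎

  ∣-of-zero-remainder : ∀ {g h q r} → h ≋ g *ₚ q +ₚ r → r ≋ [] → g ∣ h
  ∣-of-zero-remainder {g} {h} {q} h≋ r≋[] =
    divides q (≋-sym (≋-trans h≋ (≋-trans (+ₚ-cong ≋-refl r≋[]) (+ₚ-identityʳ (g *ₚ q)))))

  constₚ-*ₚ : ∀ x y → constₚ x *ₚ constₚ y ≋ constₚ (x * y)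
  constₚ-*ₚ x y = mk λ { zero → +-identityʳ _ ; (suc i) → refl }

  HasLead-0⇒≋constₚ : ∀ {g a} → HasLead g 0 a → g ≋ constₚ a
  HasLead-0⇒≋constₚ (g₀≈a , _ , above) = mk λ { zero → g₀≈a ; (suc i) → above (suc i) (s≤s z≤n) }

  K·squares-identity : ∀ n m K s t y → n -ₚ m *ₚ (y *ₚ y) ≋
    ((n -ₚ K *ₚ (s *ₚ s)) -ₚ (m -ₚ K *ₚ (t *ₚ t)) *ₚ (y *ₚ y)) +ₚ K *ₚ (s *ₚ s -ₚ (t *ₚ t) *ₚ (y *ₚ y))
  K·squares-identity = solve 6 (λ n m K s t y →
    n :- m :* (y :* y) := ((n :- K :* (s :* s)) :- (m :- K :* (t :* t)) :* (y :* y)) :+ K :* (s :* s :- (t :* t) :* (y :* y)))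
    ≋-refl

  difference-of-squares : ∀ s t α → s *ₚ s -ₚ (t *ₚ t) *ₚ ((s *ₚ α) *ₚ (s *ₚ α)) ≋
                                    (s *ₚ s) *ₚ ((1ₚ -ₚ α *ₚ t) *ₚ (1ₚ +ₚ α *ₚ t))
  difference-of-squares = solve 3 (λ s t α →
    s :* s :- (t :* t) :* ((s :* α) :* (s :* α)) := (s :* s) :* ((con (1 , 0) :- α :* t) :* (con (1 , 0) :+ α :* t)))
    ≋-refl

  module Prime (p : Poly) (p-prime : IsPrime p) where

    p-monic : ∃ λ e → HasLead p (suc e) 1#
    p-monic with proj₁ p-prime
    ... | suc e , _ , p-lead = e , p-lead

    p∤1ₚ : ¬ p ∣ 1ₚ
    p∤1ₚ = HasLead⇒∤1ₚ {p} (proj₂ p-monic)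

    ∣p⇒∣1ₚ⊎p∣ : ∀ {g} → g ∣ p → g ∣ 1ₚ ⊎ p ∣ g
    ∣p⇒∣1ₚ⊎p∣ {g} (divides q gq≋p) with proj₂ p-prime g q (coeff-≈ gq≋p)
    ... | inj₁ g-unit = inj₁ (∣ₚ⇒∣ g-unit)
    ... | inj₂ (u , qu≈1) = inj₂ (divides u
      (≋-trans (*ₚ-congˡ u (≋-sym gq≋p))
      (≋-trans (*ₚ-assoc g q u)
      (≋-trans (*ₚ-congʳ g (mk qu≈1)) (*ₚ-identityʳ g)))))

    p∣? : ∀ g → Dec (p ∣ g)
    p∣? g with p-monic
    ... | e , p-lead with divMod {p} p-lead g
    ...   | q , r , g≋ , r-below with zero-or-HasLead r
    ...     | inj₁ r≋[] = yes (∣-of-zero-remainder g≋ r≋[])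
    ...     | inj₂ (d , a , r-lead) = no λ p∣g →
      ℕ.<⇒≱ (DegreeBelow-HasLead⇒< {r} r-below r-lead)
            (∣⇒deg≤ {p} p-lead (∣-resp-≋ r≋ (∣-minus p∣g (∣-*ʳ q ∣-refl))) r-lead)
      where
      r≋ : g -ₚ p *ₚ q ≋ r
      r≋ = ≋-trans (+ₚ-cong g≋ ≋-refl) (solve 2 (λ u r → (u :+ r) :- u := r) ≋-refl (p *ₚ q) r)

    module _ {f : Poly} where

      Combination : Poly → Set (c ⊔ ℓ)
      Combination g = ∃ λ α → ∃ λ β → α *ₚ f +ₚ β *ₚ p ≋ g

      Combination-resp-≋ : ∀ {g h} → g ≋ h → Combination g → Combination h
      Combination-resp-≋ g≋h (α , β , eq) = α , β , ≋-trans eq g≋h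

      f-Combination : Combination f
      f-Combination = 1ₚ , [] , ≋-trans (+ₚ-identityʳ (1ₚ *ₚ f)) (*ₚ-identityˡ f)

      p-Combination : Combination p
      p-Combination = [] , 1ₚ , *ₚ-identityˡ p

      *ₚ-Combination : ∀ {g} u → Combination g → Combination (u *ₚ g)
      *ₚ-Combination {g} u (α , β , eq) = u *ₚ α , u *ₚ β ,
        ≋-trans (solve 5 (λ u α β f p → (u :* α) :* f :+ (u :* β) :* p := u :* (α :* f :+ β :* p)) ≋-refl u α β f p)
                (*ₚ-congʳ u eq)

      Combination-minus : ∀ {g h} → Combination g → Combination h → Combination (g -ₚ h)
      Combination-minus {g} {h} (α , β , αf+βp≋g) (α′ , β′ , α′f+β′p≋h) = α -ₚ α′ , β -ₚ β′ ,
        ≋-trans (solve 6 (λ α β α′ β′ f p →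
                           (α :- α′) :* f :+ (β :- β′) :* p := (α :* f :+ β :* p) :- (α′ :* f :+ β′ :* p))
                         ≋-refl α β α′ β′ f p)
                (+ₚ-cong αf+βp≋g (-ₚ-cong α′f+β′p≋h))

      remainder-Combination : ∀ {g h q r} → Combination g → Combination h → h ≋ g *ₚ q +ₚ r → Combination r
      remainder-Combination {g} {h} {q} {r} g-comb h-comb h≋gq+r =
        Combination-resp-≋ (≋-trans (+ₚ-cong h≋gq+r (-ₚ-cong (*ₚ-comm q g)))
                                    (solve 2 (λ u r → (u :+ r) :- u := r) ≋-refl (g *ₚ q) r))
                           (Combination-minus h-comb (*ₚ-Combination q g-comb))

      -- Euclid's algorithm: dividing f and p by a combination g leaves combinations of smaller
      -- degree, unless g divides both, which for deg g ≥ 1 contradicts p ∤ f.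
      Combination-1ₚ : ¬ p ∣ f → ∀ d {g a} → Combination g → HasLead g d a → Combination 1ₚ
      Combination-1ₚ p∤f = <-rec (λ d → ∀ {g a} → Combination g → HasLead g d a → Combination 1ₚ) step
        where
        step : ∀ d → (∀ {d′} → d′ ℕ.< d → ∀ {g a} → Combination g → HasLead g d′ a → Combination 1ₚ) →
               ∀ {g a} → Combination g → HasLead g d a → Combination 1ₚ
        step zero _ {g} {a} g-comb g-lead@(_ , a≉0 , _) with invert a a≉0
        ... | a⁻¹ , aa⁻¹≈1 = Combination-resp-≋
          (≋-trans (*ₚ-congʳ (constₚ a⁻¹) (HasLead-0⇒≋constₚ {g} g-lead))
          (≋-trans (constₚ-*ₚ a⁻¹ a) (cons-cong (trans (*-comm a⁻¹ a) aa⁻¹≈1) ≋-refl)))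
          (*ₚ-Combination (constₚ a⁻¹) g-comb)
        step (suc e) smaller {g} g-comb g-lead
          with divMod {g} g-lead f | divMod {g} g-lead p
        ... | qf , rf , f≋ , rf-below | qp , rp , p≋ , rp-below
          with zero-or-HasLead rf | zero-or-HasLead rp
        ... | inj₂ (_ , _ , rf-lead) | _ =
          smaller (DegreeBelow-HasLead⇒< {rf} rf-below rf-lead) (remainder-Combination g-comb f-Combination f≋) rf-lead
        ... | inj₁ _ | inj₂ (_ , _ , rp-lead) =
          smaller (DegreeBelow-HasLead⇒< {rp} rp-below rp-lead) (remainder-Combination g-comb p-Combination p≋) rp-lead
        ... | inj₁ rf≋[] | inj₁ rp≋[] with ∣p⇒∣1ₚ⊎p∣ (∣-of-zero-remainder p≋ rp≋[])
        ...   | inj₁ g∣1 = ⊥-elim (HasLead⇒∤1ₚ {g} g-lead g∣1)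
        ...   | inj₂ p∣g = ⊥-elim (p∤f (∣-trans p∣g (∣-of-zero-remainder f≋ rf≋[])))

      bezout : ¬ p ∣ f → Combination 1ₚ
      bezout p∤f = Combination-1ₚ p∤f _ p-Combination (proj₂ p-monic)

    p∤* : ∀ {s u} → ¬ p ∣ s → ¬ p ∣ u → ¬ p ∣ s *ₚ u
    p∤* {s} {u} p∤s p∤u p∣su with bezout p∤s
    ... | α , β , αs+βp≋1 = p∤u (∣-resp-≋ u≋ (∣-+ (∣-*ˡ α p∣su) (∣-*ʳ (β *ₚ u) ∣-refl)))
      where
      u≋ : α *ₚ (s *ₚ u) +ₚ p *ₚ (β *ₚ u) ≋ u
      u≋ = ≋-trans (solve 5 (λ α β s u p → α :* (s :* u) :+ p :* (β :* u) := (α :* s :+ β :* p) :* u) ≋-refl α β s u p)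
                   (≋-trans (*ₚ-congˡ u αs+βp≋1) (*ₚ-identityˡ u))

    inverse-mod-p : ∀ {t} → ¬ p ∣ t → ∃ λ α → p ∣ 1ₚ -ₚ α *ₚ t
    inverse-mod-p {t} p∤t with bezout p∤t
    ... | α , β , αt+βp≋1 = α , ∣-resp-≋ βp≋ (∣-*ˡ β ∣-refl)
      where
      βp≋ : β *ₚ p ≋ 1ₚ -ₚ α *ₚ t
      βp≋ = ≋-trans (solve 4 (λ α t β p → β :* p := (α :* t :+ β :* p) :- α :* t) ≋-refl α t β p)
                    (+ₚ-cong αt+βp≋1 ≋-refl)

    inverse-mod-p-∤ : ∀ {α t} → p ∣ 1ₚ -ₚ α *ₚ t → ¬ p ∣ α
    inverse-mod-p-∤ {α} {t} p∣1-αt p∣α = p∤1ₚ (∣-resp-≋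
      (solve 2 (λ α t → (con (1 , 0) :- α :* t) :+ α :* t := con (1 , 0)) ≋-refl α t)
      (∣-+ p∣1-αt (∣-*ʳ t p∣α)))

    Coprime⇒p∤ : ∀ {n} → Coprime n p → ¬ p ∣ n
    Coprime⇒p∤ n⊥p p∣n = p∤1ₚ (∣ₚ⇒∣ (n⊥p p (∣⇒∣ₚ p∣n) (∣⇒∣ₚ (∣-refl {p}))))

    sameSqClass : ∀ {a b} y → ¬ p ∣ y → p ∣ a -ₚ b *ₚ (y *ₚ y) → SameSqClass p a b
    sameSqClass y p∤y p∣a-by² = y , (λ p∣y → p∤y (∣ₚ⇒∣ p∣y)) , ∣⇒∣ₚ p∣a-by²

    SameSqClass-resp-≋ : ∀ {a a′ b b′} → a ≋ a′ → b ≋ b′ → SameSqClass p a b → SameSqClass p a′ b′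
    SameSqClass-resp-≋ {b = b} {b′} a≋a′ b≋b′ (y , p∤y , p∣a-by²) = y , p∤y ,
      ∣⇒∣ₚ (∣-resp-≋ (+ₚ-cong a≋a′ (-ₚ-cong (*ₚ-congˡ {b} {b′} (y *ₚ y) b≋b′)))
                     (∣ₚ⇒∣ {p} p∣a-by²))

    -- The witness is y = s α, where α t ≡ 1 modulo p.
    SameSqClass-of-K·squares : ∀ {n m} K s t → ¬ p ∣ s → ¬ p ∣ t →
      p ∣ n -ₚ K *ₚ (s *ₚ s) → p ∣ m -ₚ K *ₚ (t *ₚ t) → SameSqClass p n m
    SameSqClass-of-K·squares {n} {m} K s t p∤s p∤t p∣n-Ks² p∣m-Kt² =
      sameSqClass {n} {m} (s *ₚ α) (p∤* p∤s (inverse-mod-p-∤ p∣1-αt))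
        (∣-resp-≋ (≋-sym (K·squares-identity n m K s t (s *ₚ α)))
          (∣-+ (∣-minus p∣n-Ks² (∣-*ʳ ((s *ₚ α) *ₚ (s *ₚ α)) p∣m-Kt²))
               (∣-*ˡ K (∣-resp-≋ (≋-sym (difference-of-squares s t α))
                                 (∣-*ˡ (s *ₚ s) (∣-*ʳ (1ₚ +ₚ α *ₚ t) p∣1-αt))))))
      where
      α = proj₁ (inverse-mod-p p∤t)
      p∣1-αt = proj₂ (inverse-mod-p p∤t)

    ValuesAreSquaresTimes : Form → Poly → Set (c ⊔ ℓ)
    ValuesAreSquaresTimes Q K =
      ∀ {n x y} → eval Q x y ≋ n → ¬ p ∣ n → ∃ λ s → ¬ p ∣ s × p ∣ n -ₚ K *ₚ (s *ₚ s)

    -- For p ∤ a, completing the square gives a n ≡ (a x + b y)² modulo p.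
    values-≡-a⁻¹·square : ∀ {a b c′} → p ∣ disc (form a b c′) → ¬ p ∣ a →
                          ∃ (ValuesAreSquaresTimes (form a b c′))
    values-≡-a⁻¹·square {a} {b} {c′} p∣D p∤a = α , values
      where
      α = proj₁ (inverse-mod-p p∤a)
      p∣1-αa = proj₂ (inverse-mod-p p∤a)
      values : ValuesAreSquaresTimes (form a b c′) α
      values {n} {x} {y} Qxy≋n p∤n = z , p∤z , p∣n-αz²
        where
        z = a *ₚ x +ₚ b *ₚ y
        an≋ : a *ₚ n ≋ z *ₚ z -ₚ disc (form a b c′) *ₚ (y *ₚ y)
        an≋ = ≋-trans (*ₚ-congʳ a (≋-sym Qxy≋n)) (completing-the-square a b c′ x y)
        p∤z : ¬ p ∣ z
        p∤z p∣z = p∤* p∤a p∤n (∣-resp-≋ (≋-sym an≋) (∣-minus (∣-*ʳ z p∣z) (∣-*ʳ (y *ₚ y) p∣D)))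
        p∣an-z² : p ∣ a *ₚ n -ₚ z *ₚ z
        p∣an-z² = ∣-resp-≋
          (≋-sym (≋-trans (+ₚ-cong an≋ ≋-refl)
                          (solve 2 (λ Z W → (Z :- W) :- Z := :- W) ≋-refl (z *ₚ z) (disc (form a b c′) *ₚ (y *ₚ y)))))
          (∣-negₚ (∣-*ʳ (y *ₚ y) p∣D))
        p∣n-αz² : p ∣ n -ₚ α *ₚ (z *ₚ z)
        p∣n-αz² = ∣-resp-≋
          (solve 4 (λ n α a z → n :* (con (1 , 0) :- α :* a) :+ α :* (a :* n :- z :* z) := n :- α :* (z :* z)) ≋-refl n α a z)
          (∣-+ (∣-*ˡ n p∣1-αa) (∣-*ˡ α p∣an-z²))

    -- For p ∣ a, also p ∣ b because b² = disc + a c, so n ≡ c y² modulo p.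
    values-≡-c·square : ∀ {a b c′} → p ∣ disc (form a b c′) → p ∣ a →
                        ValuesAreSquaresTimes (form a b c′) c′
    values-≡-c·square {a} {b} {c′} p∣D p∣a {n} {x} {y} ev p∤n =
      y , (λ p∣y → p∤n (∣-resp-≋ ev (∣-+ p∣ax²+2bxy (∣-*ˡ c′ (∣-*ʳ y p∣y))))) ,
      ∣-resp-≋ (≋-trans (solve 5 (λ a b c′ x y → a :* (x :* x) :+ con (2 , 0) :* b :* x :* y
                                     := (a :* (x :* x) :+ con (2 , 0) :* b :* x :* y :+ c′ :* (y :* y)) :- c′ :* (y :* y))
                                 ≋-refl a b c′ x y)
                        (+ₚ-cong ev ≋-refl))
               p∣ax²+2bxy
      where
      p∣b : p ∣ b
      p∣b with p∣? b
      ... | yes p∣b = p∣b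
      ... | no p∤b  = ⊥-elim (p∤* p∤b p∤b (∣-resp-≋
        (solve 3 (λ a b c′ → (b :* b :- a :* c′) :+ a :* c′ := b :* b) ≋-refl a b c′)
        (∣-+ p∣D (∣-*ʳ c′ p∣a))))
      p∣ax²+2bxy : p ∣ a *ₚ (x *ₚ x) +ₚ 2ₚ *ₚ b *ₚ x *ₚ y
      p∣ax²+2bxy = ∣-+ (∣-*ʳ (x *ₚ x) p∣a) (∣-*ʳ y (∣-*ʳ x (∣-*ˡ 2ₚ p∣b)))

    values-≡-K·square : ∀ {Q} → p ∣ disc Q → ∃ (ValuesAreSquaresTimes Q)
    values-≡-K·square {form a b c′} p∣D with p∣? a
    ... | yes p∣a = c′ , values-≡-c·square {a} {b} {c′} p∣D p∣a
    ... | no p∤a  = values-≡-a⁻¹·square {a} {b} {c′} p∣D p∤a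

    SameSqClass-refl : ∀ {a} → SameSqClass p a a
    SameSqClass-refl {a} = sameSqClass {a} {a} 1ₚ p∤1ₚ (∣-resp-≋ (≋-sym a-a1≋[]) ∣-[])
      where
      a-a1≋[] : a -ₚ a *ₚ (1ₚ *ₚ 1ₚ) ≋ []
      a-a1≋[] = solve 1 (λ a → a :- a :* (con (1 , 0) :* con (1 , 0)) := con (0 , 0)) ≋-refl a

    p^suc∣⇒p∣ : ∀ {D} v → (p ^ₚ suc v) ∣ₚ D → p ∣ D
    p^suc∣⇒p∣ v p^sv∣D = ∣-trans (divides (p ^ₚ v) ≋-refl) (∣ₚ⇒∣ p^sv∣D)

    SquareFree⇒p²∤ : ∀ {D} v → SquareFree D → ¬ (p ^ₚ suc (suc v)) ∣ₚ D
    SquareFree⇒p²∤ {D} v D-sf p^ssv∣D =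
      p∤1ₚ (∣ₚ⇒∣ {p} (D-sf p (∣⇒∣ₚ {p *ₚ p} {D} p²∣D)))
      where
      p²∣D : p *ₚ p ∣ D
      p²∣D = ∣-trans (divides (p ^ₚ v) (*ₚ-assoc p p (p ^ₚ v))) (∣ₚ⇒∣ {p ^ₚ suc (suc v)} p^ssv∣D)

    represented-SameSqClass : ∀ {D Q v} → In𝒬 D Q → SquareFree D → Val p D v →
      ∀ {n m} → Coprime n p → ProperlyRepresents Q n → Coprime m p → ProperlyRepresents Q m →
      SameSqClass p (n ^ₚ v) (m ^ₚ v)
    represented-SameSqClass {v = zero} _ _ _ _ _ _ _ = SameSqClass-refl {1ₚ}
    represented-SameSqClass {D} {v = suc (suc v)} _ D-sf (p^v∣D , _) = ⊥-elim (SquareFree⇒p²∤ {D} v D-sf p^v∣D)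
    represented-SameSqClass {D} {Q} {v = 1} (disc≈D , _) _ (p∣D , _) {n} {m}
                            n⊥p (x , y , _ , Qxy≈n) m⊥p (x′ , y′ , _ , Qx′y′≈m)
      with values-≡-K·square {Q} (∣-resp-≋ (≋-sym (mk {disc Q} {D} disc≈D)) (p^suc∣⇒p∣ {D} 0 p∣D))
    ... | K , values with values (mk {eval Q x y} {n} Qxy≈n) (Coprime⇒p∤ {n} n⊥p)
                        | values (mk {eval Q x′ y′} {m} Qx′y′≈m) (Coprime⇒p∤ {m} m⊥p)
    ...   | s , p∤s , p∣n-Ks² | t , p∤t , p∣m-Kt² =
      SameSqClass-resp-≋ (≋-sym (*ₚ-identityʳ n)) (≋-sym (*ₚ-identityʳ m))
        (SameSqClass-of-K·squares {n} {m} K s t p∤s p∤t p∣n-Ks² p∣m-Kt²)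

    p∤-SameSqClass-1ₚ : ∀ {D v} → ¬ p ∣ₚ D → Val p D v → ∀ n → SameSqClass p (n ^ₚ v) 1ₚ
    p∤-SameSqClass-1ₚ {v = zero}  _   _           n = SameSqClass-refl {1ₚ}
    p∤-SameSqClass-1ₚ {D} {suc v} p∤D (p^v∣D , _) n = ⊥-elim (p∤D (∣⇒∣ₚ {p} (p^suc∣⇒p∣ {D} v p^v∣D)))

  -- Signs of leading coefficients

  Positive-HasLead : ∀ {f d a} → Positive f → HasLead f d a → IsSquareₖ ((- 1#) ^ₖ d * a)
  Positive-HasLead {f} (d′ , a′ , f-lead′ , sq) f-lead with HasLead-unique {f} f-lead′ f-lead
  ... | ≡.refl , a′≈a = IsSquareₖ-cong (*-congˡ a′≈a) sq

  Positive-resp-≋ : ∀ {f g} → f ≋ g → Positive f → Positive g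
  Positive-resp-≋ {f} f≋g (d , a , f-lead , sq) = d , a , HasLead-resp-≋ {f} f≋g f-lead , sq

  Positive-*ₚ : ∀ {f g} → Positive f → Positive g → Positive (f *ₚ g)
  Positive-*ₚ {f} {g} (d , a , f-lead , sq-f) (e , b , g-lead , sq-g) =
    d ℕ.+ e , a * b , HasLead-*ₚ {f} {g} f-lead g-lead ,
    IsSquareₖ-cong (sym (-1^ₖ-interchange d e a b)) (IsSquareₖ-* sq-f sq-g)

  ZeroOrPositive : Poly → Set (c ⊔ ℓ)
  ZeroOrPositive f = f ≋ [] ⊎ Positive f

  ZeroOrPositive-resp-≋ : ∀ {f g} → f ≋ g → ZeroOrPositive f → ZeroOrPositive g
  ZeroOrPositive-resp-≋ f≋g (inj₁ f≋[]) = inj₁ (≋-trans (≋-sym f≋g) f≋[])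
  ZeroOrPositive-resp-≋ f≋g (inj₂ f-pos) = inj₂ (Positive-resp-≋ f≋g f-pos)

  square-ZeroOrPositive : ∀ z → ZeroOrPositive (z *ₚ z)
  square-ZeroOrPositive z with zero-or-HasLead z
  ... | inj₁ z≋[] = inj₁ (≋-trans (*ₚ-congʳ z z≋[]) (*ₚ-zeroʳ z))
  ... | inj₂ (d , a , z-lead) = inj₂ (d ℕ.+ d , a * a , HasLead-*ₚ {z} {z} z-lead z-lead ,
    IsSquareₖ-cong (sym (-1^ₖ-interchange d d a a)) (x*x-IsSquareₖ _))

  Positive-*ₚ-ZeroOrPositive : ∀ {f g} → Positive f → ZeroOrPositive g → ZeroOrPositive (f *ₚ g)
  Positive-*ₚ-ZeroOrPositive {f} f-pos (inj₁ g≋[]) = inj₁ (≋-trans (*ₚ-congʳ f g≋[]) (*ₚ-zeroʳ f))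
  Positive-*ₚ-ZeroOrPositive {f} {g} f-pos (inj₂ g-pos) = inj₂ (Positive-*ₚ {f} {g} f-pos g-pos)

  ZeroOrPositive-cancelˡ : ∀ {f g} → Positive f → ZeroOrPositive (f *ₚ g) → ZeroOrPositive g
  ZeroOrPositive-cancelˡ {f} {g} (d , a , f-lead , sq-f) fg-zp with zero-or-HasLead g
  ... | inj₁ g≋[] = inj₁ g≋[]
  ... | inj₂ (e , b , g-lead) = inj₂ (e , b , g-lead ,
    IsSquareₖ-cancelˡ (*-≉0 (-1^ₖ-≉0 d) (proj₁ (proj₂ f-lead))) sq-f
      (IsSquareₖ-cong (-1^ₖ-interchange d e a b) (Positive-HasLead {f *ₚ g} fg-pos fg-lead)))
    where
    fg-lead : HasLead (f *ₚ g) (d ℕ.+ e) (a * b)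
    fg-lead = HasLead-*ₚ {f} {g} f-lead g-lead
    fg-pos : Positive (f *ₚ g)
    fg-pos = [ (λ fg≋[] → ⊥-elim (HasLead⇒≉[] {f *ₚ g} fg-lead fg≋[])) , (λ pos → pos) ] fg-zp

  ZeroOrPositive-+ₚ : ∀ {f g} → (∀ {d e a b} → HasLead f d a → HasLead g e b → d ≢ e) →
                      ZeroOrPositive f → ZeroOrPositive g → ZeroOrPositive (f +ₚ g)
  ZeroOrPositive-+ₚ {f} {g} _ (inj₁ f≋[]) g-zp =
    ZeroOrPositive-resp-≋ (+ₚ-cong {[]} {f} (≋-sym f≋[]) ≋-refl) g-zp
  ZeroOrPositive-+ₚ {f} {g} _ f-zp (inj₁ g≋[]) =
    ZeroOrPositive-resp-≋ (≋-trans (≋-sym (+ₚ-identityʳ f)) (+ₚ-cong ≋-refl (≋-sym g≋[]))) f-zp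
  ZeroOrPositive-+ₚ {f} {g} d≢e (inj₂ (d , a , f-lead , sq-f)) (inj₂ (e , b , g-lead , sq-g))
    with ℕ.<-cmp d e
  ... | tri< d<e _ _ = inj₂ (e , b , HasLead-+ʳ {f} {g} (HasLead⇒DegreeBelow {f} f-lead d<e) g-lead , sq-g)
  ... | tri≈ _ d≡e _ = ⊥-elim (d≢e f-lead g-lead d≡e)
  ... | tri> _ _ e<d = inj₂ (d , a , HasLead-+ˡ {f} {g} f-lead (HasLead⇒DegreeBelow {g} g-lead e<d) , sq-f)

  HasLead-square-even : ∀ {z d a} → HasLead (z *ₚ z) d a → ∃ λ m → d ≡ 2 ℕ.* m
  HasLead-square-even {z} zz-lead with zero-or-HasLead z
  ... | inj₁ z≋[] = ⊥-elim (HasLead⇒≉[] {z *ₚ z} zz-lead (≋-trans (*ₚ-congʳ z z≋[]) (*ₚ-zeroʳ z)))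
  ... | inj₂ (e , b , z-lead) with HasLead-unique {z *ₚ z} zz-lead (HasLead-*ₚ {z} {z} z-lead z-lead)
  ...   | ≡.refl , _ = e , ≡.cong (e ℕ.+_) (≡.sym (ℕ.+-identityʳ e))

  HasLead-odd-*ₚ-square : ∀ {g y m b e a} → HasLead g (suc (2 ℕ.* m)) b → HasLead (g *ₚ (y *ₚ y)) e a →
                          ∃ λ m′ → e ≡ suc (2 ℕ.* m′)
  HasLead-odd-*ₚ-square {g} {y} {m} g-lead gyy-lead with zero-or-HasLead y
  ... | inj₁ y≋[] = ⊥-elim (HasLead⇒≉[] {g *ₚ (y *ₚ y)} gyy-lead
          (≋-trans (*ₚ-congʳ g (≋-trans (*ₚ-congʳ y y≋[]) (*ₚ-zeroʳ y))) (*ₚ-zeroʳ g)))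
  ... | inj₂ (e , _ , y-lead)
    with HasLead-unique {g *ₚ (y *ₚ y)} gyy-lead (HasLead-*ₚ {g} {y *ₚ y} g-lead (HasLead-*ₚ {y} {y} y-lead y-lead))
  ...   | ≡.refl , _ = m ℕ.+ e , odd+even m e
    where
    odd+even : ∀ m e → suc (2 ℕ.* m) ℕ.+ (e ℕ.+ e) ≡ suc (2 ℕ.* (m ℕ.+ e))
    odd+even = solve-∀

  Negative-odd-degree-lead-IsSquareₖ : ∀ {D m D₀} → Negative D → HasLead D (suc (2 ℕ.* m)) D₀ → IsSquareₖ D₀
  Negative-odd-degree-lead-IsSquareₖ {D} {m} {D₀} D-neg D-lead =
    IsSquareₖ-cong (trans (*-congʳ (-1^ₖ-odd m)) (trans (-1*x≈-x (- D₀)) (⁻¹-involutive D₀)))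
      (Positive-HasLead { -ₚ D} D-neg (HasLead-negₚ {D} D-lead))

  -- With z = a x + b y, a n = z² + (−D) y², and the two summands have degrees of different parity.
  represented-ZeroOrPositive : ∀ {D Q n} → Negative D → OddDegree D → In𝒬 D Q →
                               ProperlyRepresents Q n → ZeroOrPositive n
  represented-ZeroOrPositive {D} {form a b c′} {n} D-neg (_ , _ , D-lead , m , ≡.refl) (disc≈D , a-pos) (x , y , _ , Qxy≈n) =
    ZeroOrPositive-cancelˡ {a} a-pos (ZeroOrPositive-resp-≋ (≋-sym an≋)
      (ZeroOrPositive-+ₚ degrees-differ (square-ZeroOrPositive z)
        (Positive-*ₚ-ZeroOrPositive { -ₚ D} D-neg (square-ZeroOrPositive y))))
    where
    z = a *ₚ x +ₚ b *ₚ y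
    an≋ : a *ₚ n ≋ z *ₚ z +ₚ (-ₚ D) *ₚ (y *ₚ y)
    an≋ = ≋-trans (*ₚ-congʳ a (≋-sym (mk Qxy≈n)))
          (≋-trans (completing-the-square a b c′ x y)
          (≋-trans (+ₚ-cong ≋-refl (-ₚ-cong (*ₚ-congˡ (y *ₚ y) (mk {disc (form a b c′)} {D} disc≈D))))
                   (solve 3 (λ Z D Y → Z :- D :* Y := Z :+ (:- D) :* Y) ≋-refl (z *ₚ z) D (y *ₚ y))))
    degrees-differ : ∀ {d e a b} → HasLead (z *ₚ z) d a → HasLead ((-ₚ D) *ₚ (y *ₚ y)) e b → d ≢ e
    degrees-differ zz-lead Dyy-lead
      with HasLead-square-even {z} zz-lead | HasLead-odd-*ₚ-square { -ₚ D} {y} {m} (HasLead-negₚ {D} D-lead) Dyy-lead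
    ... | m₁ , ≡.refl | m₂ , ≡.refl = ℕ.even≢odd m₁ m₂

  Positive⇒InftySymbolTrivial : ∀ {n D dn n₀ m D₀} → Positive n → Negative D →
    HasLead n dn n₀ → HasLead D (suc (2 ℕ.* m)) D₀ → InftySymbolTrivial dn n₀ (suc (2 ℕ.* m)) D₀
  Positive⇒InftySymbolTrivial {n} {D} {dn} {n₀} {m} {D₀} n-pos D-neg n-lead D-lead =
    IsSquareₖ-cong (*-congʳ (sym signs))
      (IsSquareₖ-* (IsSquareₖ-^ₖ dD (Positive-HasLead {n} n-pos n-lead))
                   (IsSquareₖ-^ₖ dn (Negative-odd-degree-lead-IsSquareₖ {D} {m} D-neg D-lead)))
    where
    dD = suc (2 ℕ.* m)
    signs : (- 1#) ^ₖ (dn ℕ.* dD) * n₀ ^ₖ dD ≈ ((- 1#) ^ₖ dn * n₀) ^ₖ dD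
    signs = trans (*-congʳ (^ₖ-*ℕ (- 1#) dn dD)) (sym (^ₖ-distrib-* ((- 1#) ^ₖ dn) n₀ dD))

  infinite-place : ∀ {D Q} → Negative D → OddDegree D → In𝒬 D Q →
    ∀ n → ProperlyRepresents Q n → ∀ dn dD n₀ D₀ → HasLead n dn n₀ → HasLead D dD D₀ →
    InftySymbolTrivial dn n₀ dD D₀
  infinite-place {D} {Q} D-neg D-odd@(_ , _ , D-lead′ , m , ≡.refl) Q∈ n Qn dn dD n₀ D₀ n-lead D-lead
    with HasLead-unique {D} D-lead′ D-lead
  ... | ≡.refl , _ =
    [ (λ n≋[] → ⊥-elim (HasLead⇒≉[] {n} n-lead n≋[]))
    , (λ n-pos → Positive⇒InftySymbolTrivial {n} {D} {m = m} n-pos D-neg n-lead D-lead)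
    ] (represented-ZeroOrPositive {D} {Q} {n} D-neg D-odd Q∈ Qn)

lemma8 : ∀ {c ℓ : Level} (k : NumberField c ℓ) → let open NumberField k using (Carrier) in let open PolyOver k in
    (D : Poly) → Negative D → SquareFree D → OddDegree D →
    (Q : Form) → In𝒬 D Q →
    (∀ (p : Poly) → IsPrime p → (v : ℕ) → Val p D v →
       (∀ (n m : Poly) → Coprime n p → ProperlyRepresents Q n →
                         Coprime m p → ProperlyRepresents Q m →
                         SameSqClass p (n ^ₚ v) (m ^ₚ v))
     × (¬ (p ∣ₚ D) → ∀ (n : Poly) → Coprime n p → ProperlyRepresents Q n →
                         SameSqClass p (n ^ₚ v) 1ₚ))
    ×
    (∀ (n : Poly) → ProperlyRepresents Q n →
       ∀ (dn dD : ℕ) (n₀ D₀ : Carrier) → HasLead n dn n₀ → HasLead D dD D₀ →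
       InftySymbolTrivial dn n₀ dD D₀)
lemma8 k D D-neg D-sf D-odd Q Q∈ =
  (λ p p-prime v val →
     (λ n m n⊥p Qn m⊥p Qm → Prime.represented-SameSqClass p p-prime {D} {Q} {v} Q∈ D-sf val {n} {m} n⊥p Qn m⊥p Qm) ,
     (λ p∤D n _ _ → Prime.p∤-SameSqClass-1ₚ p p-prime {D} {v} p∤D val n)) ,
  infinite-place {D} {Q} D-neg D-odd Q∈
  where open QuadraticForms k
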